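{- Let $M_2$ be the free monoid on two generators and $M_\omega$ the free monoid on countably many generators. Then $\preccurlyeq_{M_\omega}^2 \leq_B \preccurlyeq_{M_2}^2$.
   Context: For a countable monoid $M$ and a standard Borel space $X$ (here $X=2=\{0,1\}$), $M$ acts on $X^M$ by $(m\cdot f)(s)=f(sm)$, and $f\preccurlyeq_M^X g$ iff there is $m\in M$ with $f=m\cdot g$. $Q\leq_B Q'$ means there is a Borel map $f$ with $x\mathbin{Q}y\Leftrightarrow f(x)\mathbin{Q'}f(y)$. -}

module Defs where

open import Data.Nat using (ℕ)
open import Data.Bool using (Bool)
open import Data.List using (List; _++_)
open import Data.Product using (Σ; _×_)
open import Relation.Binary.PropositionalEquality using (_≡_)
open import Relation.Nullary using (¬_)

-- The space X^M with X = 2 = Bool, for a monoid M whose elements are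
-- words List A (the free monoid on the generator set A).
2^ : Set → Set
2^ M = M → Bool

M₂ : Set
M₂ = List Bool

Mω : Set
Mω = List ℕ

_·_ : {A : Set} → List A → 2^ (List A) → 2^ (List A)
(m · f) s = f (s ++ m)

_≼_ : {A : Set} → 2^ (List A) → 2^ (List A) → Set
f ≼ g = Σ _ λ m → ∀ s → f s ≡ (m · g) s

-- Codes for Borel subsets of the product space (I → Bool), I countable:
-- the σ-algebra generated by the subbasic cylinders {x | x i = b}.
data BorelCode (I : Set) : Set where
  cyl   : I → Bool → BorelCode I
  compl : BorelCode I → BorelCode I
  union : (ℕ → BorelCode I) → BorelCode I

⟦_⟧ : {I : Set} → BorelCode I → (I → Bool) → Set
⟦ cyl i b ⟧ x = x i ≡ b
⟦ compl c ⟧ x = ¬ ⟦ c ⟧ x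
⟦ union cs ⟧ x = Σ ℕ λ n → ⟦ cs n ⟧ x

-- A map between such spaces is Borel iff the preimage of every subbasic
-- cylinder (these generate the Borel σ-algebra) is Borel.
IsBorel : {I J : Set} → ((I → Bool) → (J → Bool)) → Set
IsBorel {I} {J} F = ∀ (j : J) (b : Bool) → Σ (BorelCode I) λ c →
  ∀ x → (⟦ c ⟧ x → F x j ≡ b) × (F x j ≡ b → ⟦ c ⟧ x)

_≤B_ : {I J : Set} → ((I → Bool) → (I → Bool) → Set) → ((J → Bool) → (J → Bool) → Set) → Set
_≤B_ {I} {J} Q Q' = Σ ((I → Bool) → (J → Bool)) λ F → IsBorel F ×
  (∀ x y → (Q x y → Q' (F x) (F y)) × (Q' (F x) (F y) → Q x y))

≼ω : 2^ Mω → 2^ Mω → Set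
≼ω = _≼_ {ℕ}

≼₂ : 2^ M₂ → 2^ M₂ → Set
≼₂ = _≼_ {Bool}

-- A binary word factors uniquely as 0^k 1 0^n₁ 1 0^n₂ ⋯ 1 0^nᵣ; decoding it as the
-- pair (k, n₁ n₂ ⋯ nᵣ) identifies the words with k = 0 with Mω, and appending such
-- a word to any w just appends its letters to the Mω-part of w. So f ↦ (w ↦ f s if
-- w decodes as (0, s)) transports right shifts of Mω to right shifts of M₂. The
-- values on k ≥ 1 are chosen so that a shift by a word with a leading 0 is never
-- possible: it would move the constant value at k = 1 to the one at k ≥ 2.
module Submission where

open import Defs
open import Data.Nat using (ℕ; zero; suc)
open import Data.Bool using (Bool; true; false; _≟_)
open import Data.List using (List; []; _∷_; _++_; replicate)
open import Data.Product using (Σ; _×_; _,_; proj₁; proj₂; map₁; map₂)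
open import Data.Empty using (⊥-elim)
open import Function using (_∘_)
open import Relation.Nullary using (Dec; yes; no)
open import Relation.Binary.PropositionalEquality
  using (_≡_; refl; sym; trans; cong; module ≡-Reasoning)

decode : List Bool → ℕ × List ℕ
decode []          = 0 , []
decode (false ∷ w) = suc (proj₁ (decode w)) , proj₂ (decode w)
decode (true ∷ w)  = 0 , proj₁ (decode w) ∷ proj₂ (decode w)

encode : List ℕ → List Bool
encode []      = []
encode (n ∷ t) = true ∷ replicate n false ++ encode t

decode-replicate : ∀ n → decode (replicate n false) ≡ (n , [])
decode-replicate zero    = refl
decode-replicate (suc n) rewrite decode-replicate n = refl

decode-++ : ∀ w {v t} → decode v ≡ (0 , t) → decode (w ++ v) ≡ map₂ (_++ t) (decode w)
decode-++ []          v≡t = v≡t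
decode-++ (false ∷ w) v≡t rewrite decode-++ w v≡t = refl
decode-++ (true ∷ w)  v≡t rewrite decode-++ w v≡t = refl

decode-encode : ∀ t → decode (encode t) ≡ (0 , t)
decode-encode []      = refl
decode-encode (n ∷ t)
  rewrite decode-++ (replicate n false) (decode-encode t) | decode-replicate n = refl

classify : 2^ Mω → ℕ × List ℕ → Bool
classify f (zero , s)        = f s
classify f (suc zero , _)    = true
classify f (suc (suc _) , _) = false

reduce : 2^ Mω → 2^ M₂
reduce f = classify f ∘ decode

classify-shift : ∀ {f g t} → (∀ s → f s ≡ (t · g) s) →
                 ∀ d → classify f d ≡ classify g (map₂ (_++ t) d)
classify-shift f≡tg (zero , s)        = f≡tg s
classify-shift f≡tg (suc zero , _)    = refl
classify-shift f≡tg (suc (suc _) , _) = refl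

reduce-mono : ∀ {f g} → f ≼ g → reduce f ≼ reduce g
reduce-mono {f} {g} (t , f≡tg) = encode t , λ w → begin
  classify f (decode w)                 ≡⟨ classify-shift f≡tg (decode w) ⟩
  classify g (map₂ (_++ t) (decode w))  ≡⟨ cong (classify g) (sym (decode-++ w (decode-encode t))) ⟩
  classify g (decode (w ++ encode t))   ∎
  where open ≡-Reasoning

reduce-reflects : ∀ {f g} → reduce f ≼ reduce g → f ≼ g
reduce-reflects {f} {g} (m , Ff≡mFg) with decode m in m≡
... | zero , t = t , λ s → begin
  f s                                           ≡⟨ cong (classify f) (sym (decode-encode s)) ⟩
  reduce f (encode s)                           ≡⟨ Ff≡mFg (encode s) ⟩
  classify g (decode (encode s ++ m))           ≡⟨ cong (classify g) (decode-++ (encode s) m≡) ⟩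
  classify g (map₂ (_++ t) (decode (encode s))) ≡⟨ cong (classify g ∘ map₂ (_++ t)) (decode-encode s) ⟩
  g (s ++ t)                                    ∎
  where open ≡-Reasoning
-- At w = 0: reduce f 0 = true, but 0 m decodes with k ≥ 2, where reduce g is false.
... | suc _ , _ with trans (Ff≡mFg (false ∷ [])) (cong (classify g ∘ map₁ suc) m≡)
...   | ()

_Codes_ : {I : Set} → BorelCode I → ((I → Bool) → Set) → Set
c Codes P = ∀ x → (⟦ c ⟧ x → P x) × (P x → ⟦ c ⟧ x)

everywhere : {I : Set} → I → BorelCode I
everywhere i = union λ { zero → cyl i true ; (suc _) → cyl i false }

everywhere-holds : {I : Set} (i : I) (x : I → Bool) → ⟦ everywhere i ⟧ x
everywhere-holds i x with x i in xi≡
... | true  = 0 , xi≡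
... | false = 1 , xi≡

decidable-codable : {I : Set} {P : Set} → I → Dec P → Σ (BorelCode I) (_Codes λ _ → P)
decidable-codable i (yes p) = everywhere i ,
  λ x → (λ _ → p) , (λ _ → everywhere-holds i x)
decidable-codable i (no ¬p) = compl (everywhere i) ,
  λ x → (λ ¬all → ⊥-elim (¬all (everywhere-holds i x))) , (λ p → ⊥-elim (¬p p))

classify-codable : ∀ d b → Σ (BorelCode Mω) (_Codes λ f → classify f d ≡ b)
classify-codable (zero , s)        b = cyl s b , λ _ → (λ e → e) , (λ e → e)
classify-codable (suc zero , _)    b = decidable-codable [] (true ≟ b)
classify-codable (suc (suc _) , _) b = decidable-codable [] (false ≟ b)

reduce-borel : IsBorel reduce
reduce-borel w = classify-codable (decode w)

lemma2p8 : ≼ω ≤B ≼₂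
lemma2p8 = reduce , reduce-borel , λ f g → reduce-mono , reduce-reflects
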